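{- Let $k$, $g$, $s$ be integers. If there exists a nontrivial $(k,g,s)$-multipole $G$, then there exists a nontrivial $(k,g,s)$-multipole $H$ with $|H|=|G|$ that has no vertex of inner degree $1$.
   Context: A multipole is a finite graph in which, besides ordinary edges joining two distinct vertices (called links), there may be semiedges, i.e. edges incident with only one vertex. The order $|G|$ is the number of vertices. The degree of a vertex is the number of edges (links and semiedges) incident with it; its inner degree is the number of links incident with it. A multipole is $k$-regular if every vertex has degree $k$. The girth is the length of a shortest cycle (formed by links), or $\infty$ if there is none. A $(k,g,s)$-multipole is a $k$-regular multipole of girth at least $g$ with exactly $s$ semiedges. A $(k,g,s)$-multipole with $s\le (k-2)g$ is called nontrivial if it contains a cycle and is different from a $g$-cycle (i.e. from the multipole consisting of a cycle of length $g$ with $k-2$ semiedges at each vertex); otherwise it is trivial. -}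

module Defs where

open import Data.Nat using (ℕ; suc; _+_; _*_; _∸_; _≤_)
open import Data.Fin using (Fin; zero; suc; inject₁; fromℕ; _≟_)
open import Data.List using (List; length; filter; allFin)
open import Data.Product using (Σ; ∃; _×_; _,_; proj₁; proj₂)
open import Data.Sum using (_⊎_)
open import Relation.Nullary using (¬_; Dec)
open import Relation.Nullary.Decidable using (_⊎-dec_)
open import Relation.Binary.PropositionalEquality using (_≡_; _≢_)
open import Function.Definitions using (Injective)

-- A multipole: vertices Fin order, links indexed by Fin nlinks
-- (parallel links allowed, loops forbidden), semiedges indexed by
-- Fin nsemi, each attached to one vertex.
record Multipole : Set where
  field
    order   : ℕ
    nlinks  : ℕ
    link    : Fin nlinks → Fin order × Fin order
    link-ne : ∀ e → proj₁ (link e) ≢ proj₂ (link e)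
    nsemi   : ℕ
    semi    : Fin nsemi → Fin order

open Multipole public

module _ (G : Multipole) where

  Incident : Fin (nlinks G) → Fin (order G) → Set
  Incident e v = (proj₁ (link G e) ≡ v) ⊎ (proj₂ (link G e) ≡ v)

  incident? : (v : Fin (order G)) (e : Fin (nlinks G)) → Dec (Incident e v)
  incident? v e = (proj₁ (link G e) ≟ v) ⊎-dec (proj₂ (link G e) ≟ v)

  innerDeg : Fin (order G) → ℕ
  innerDeg v = length (filter (incident? v) (allFin (nlinks G)))

  semiDeg : Fin (order G) → ℕ
  semiDeg v = length (filter (λ j → semi G j ≟ v) (allFin (nsemi G)))

  degree : Fin (order G) → ℕ
  degree v = innerDeg v + semiDeg v

  Joins : Fin (nlinks G) → Fin (order G) → Fin (order G) → Set
  Joins e u v = (link G e ≡ (u , v)) ⊎ (link G e ≡ (v , u))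

  record Cycle (ℓ : ℕ) : Set where
    field
      len≥2  : 2 ≤ ℓ
      vs     : Fin (suc ℓ) → Fin (order G)
      es     : Fin ℓ → Fin (nlinks G)
      closed : vs (fromℕ ℓ) ≡ vs zero
      vs-inj : Injective _≡_ _≡_ (λ i → vs (inject₁ i))
      es-inj : Injective _≡_ _≡_ es
      joins  : ∀ i → Joins (es i) (vs (inject₁ i)) (vs (suc i))

  HasCycle : Set
  HasCycle = Σ ℕ Cycle

  GirthAtLeast : ℕ → Set
  GirthAtLeast g = ∀ ℓ → Cycle ℓ → g ≤ ℓ

  KRegular : ℕ → Set
  KRegular k = ∀ v → degree v ≡ k

  -- G is (isomorphic to) the g-cycle multipole: a cycle of length g passing
  -- through all vertices and using all links, with k-2 semiedges at each vertex.
  IsGCycle : ℕ → ℕ → Set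
  IsGCycle k g =
    Σ (Cycle g) λ C →
      (∀ v → Σ (Fin g) λ i → Cycle.vs C (inject₁ i) ≡ v) ×
      (∀ e → Σ (Fin g) λ i → Cycle.es C i ≡ e) ×
      (∀ v → semiDeg v ≡ k ∸ 2)

IsKGS : ℕ → ℕ → ℕ → Multipole → Set
IsKGS k g s G = KRegular G k × GirthAtLeast G g × nsemi G ≡ s

-- nontrivial (k,g,s)-multipole; s ≤ (k-2)g is written s + 2g ≤ kg
Nontrivial : ℕ → ℕ → ℕ → Multipole → Set
Nontrivial k g s G =
  IsKGS k g s G × s + 2 * g ≤ k * g × HasCycle G × ¬ IsGCycle G k g

{-# OPTIONS --safe #-}
-- Let v be a vertex of inner degree 1, joined by the link e₀ to u, and let e₁ = c₀c₁ be a link of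
-- a cycle C; v lies on no cycle, and since k ≥ 2 it carries a semiedge.  Re-attach e₀ as c₀v and e₁
-- as vc₁ (subdividing e₁ by v) and move the semiedge from v to u.  Every degree is unchanged, and
-- so are the order and the numbers of links and semiedges.  A cycle through v now runs c₀ v c₁, and
-- shortcutting it by the old link e₁ gives a cycle of the old multipole that is one shorter, so the
-- girth stays at least g.  C with v inserted is a cycle of length greater than g, so the new
-- multipole is not the g-cycle.  As the cycle grows with each step but can never be longer than the
-- fixed number of links, repeating the step ends in a multipole without vertices of inner degree 1.
module Submission where

open import Defs
open import Data.Nat using (ℕ)
open import Data.Product using (Σ; _×_)
open import Relation.Binary.PropositionalEquality using (_≡_; _≢_)

open import Data.Bool using (true; false; if_then_else_)
open import Data.Fin as Fin using (Fin; zero; suc; toℕ; fromℕ; fromℕ<; inject₁; punchIn)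
open import Data.Fin.Properties
  using (any?; punchInᵢ≢i; injective⇒≤; toℕ-injective; toℕ<n; toℕ-fromℕ; toℕ-fromℕ<; toℕ-inject₁)
open import Data.List using (List; []; _∷_; length; filter; allFin; tabulate)
open import Data.List.Membership.Propositional using (_∈_)
open import Data.List.Membership.Propositional.Properties using (∈-filter⁺; ∈-filter⁻; ∈-allFin)
open import Data.List.Relation.Unary.Any using (here)
open import Data.Nat using (zero; suc; _+_; _*_; _≤_; _<_; z≤n; s≤s; z<s; NonZero; >-nonZero)
open import Data.Nat.DivMod using (_%_; _mod_; m<n⇒m%n≡m; m%n<n; n%n≡0; [m+n]%n≡m%n)
open import Data.Nat.Properties
open import Data.Nat.Tactic.RingSolver using (solve-∀)
open import Algebra.Properties.CommutativeMonoid.Sum +-0-commutativeMonoid using (sum; sum-remove; sum-cong-≗)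
open import Data.Product using (∃; _,_; proj₁; proj₂)
open import Data.Sum using (_⊎_; inj₁; inj₂)
open import Data.Vec.Functional using (updateAt)
open import Data.Vec.Functional.Properties using (updateAt-updates; updateAt-minimal)
open import Function using (_∘_)
open import Level using (Level)
open import Relation.Binary.PropositionalEquality
  using (refl; sym; trans; cong; cong₂; subst; subst₂; module ≡-Reasoning)
open import Relation.Nullary using (Dec; does; yes; no; ¬_; contradiction)
open import Relation.Nullary.Decidable using (_⊎-dec_)
open import Relation.Unary using (Pred; Decidable)

private
  variable
    a p : Level
    A : Set a
    n : ℕ

𝟙 : Dec A → ℕ
𝟙 d = if does d then 1 else 0

length-filter-tabulate : {P : Pred A p} (P? : Decidable P) (f : Fin n → A) →
  length (filter P? (tabulate f)) ≡ sum (λ i → 𝟙 (P? (f i)))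
length-filter-tabulate {n = zero}  P? f = refl
length-filter-tabulate {n = suc n} P? f with does (P? (f zero))
... | true  = cong suc (length-filter-tabulate P? (f ∘ suc))
... | false = length-filter-tabulate P? (f ∘ suc)

sum-update : (f f′ : Fin n → ℕ) (j : Fin n) → (∀ i → i ≢ j → f i ≡ f′ i) →
  sum f + f′ j ≡ sum f′ + f j
sum-update {n = suc n} f f′ j agree = begin
  sum f + f′ j                              ≡⟨ cong (_+ f′ j) (sum-remove {i = j} f) ⟩
  f j + sum (f ∘ punchIn j) + f′ j
    ≡⟨ cong (λ s → f j + s + f′ j) (sum-cong-≗ (λ i → agree _ (punchInᵢ≢i j i))) ⟩
  f j + sum (f′ ∘ punchIn j) + f′ j         ≡⟨ exchange (f j) _ (f′ j) ⟩
  f′ j + sum (f′ ∘ punchIn j) + f j         ≡⟨ cong (_+ f j) (sum-remove {i = j} f′) ⟨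
  sum f′ + f j                              ∎
  where
  open ≡-Reasoning
  exchange : ∀ x s y → x + s + y ≡ y + s + x
  exchange = solve-∀

∈-nonempty : {xs : List A} → 1 ≤ length xs → ∃ (_∈ xs)
∈-nonempty {xs = x ∷ _} _ = x , here refl

∈-length≤1 : {xs : List A} {x y : A} → length xs ≤ 1 → x ∈ xs → y ∈ xs → x ≡ y
∈-length≤1 {xs = _ ∷ []}    _        (here refl) (here refl) = refl
∈-length≤1 {xs = _ ∷ _ ∷ _} (s≤s ()) _           _

module _ {P : Pred (Fin n) p} (P? : Decidable P) where

  count : ℕ
  count = length (filter P? (allFin n))

  count≥1⇒∃ : 1 ≤ count → ∃ P
  count≥1⇒∃ 1≤c with x , x∈ ← ∈-nonempty {xs = filter P? (allFin n)} 1≤c =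
    x , proj₂ (∈-filter⁻ P? {xs = allFin n} x∈)

  count≤1⇒unique : count ≤ 1 → ∀ {i j} → P i → P j → i ≡ j
  count≤1⇒unique c≤1 Pi Pj =
    ∈-length≤1 {xs = filter P? (allFin n)} c≤1 (∈-filter⁺ P? (∈-allFin _) Pi) (∈-filter⁺ P? (∈-allFin _) Pj)

  ≢⇒count≥2 : ∀ {i j} → i ≢ j → P i → P j → 2 ≤ count
  ≢⇒count≥2 i≢j Pi Pj = ≰⇒> λ c≤1 → i≢j (count≤1⇒unique c≤1 Pi Pj)

  count≡sum : count ≡ sum (λ i → 𝟙 (P? i))
  count≡sum = length-filter-tabulate P? (λ i → i)

touches : Fin n × Fin n → Fin n → ℕ
touches xy w = 𝟙 ((proj₁ xy Fin.≟ w) ⊎-dec (proj₂ xy Fin.≟ w))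

touches-≢ : ∀ {x y : Fin n} w → x ≢ y → touches (x , y) w ≡ 𝟙 (x Fin.≟ w) + 𝟙 (y Fin.≟ w)
touches-≢ {x = x} {y} w x≢y with x Fin.≟ w | y Fin.≟ w
... | yes refl | yes refl = contradiction refl x≢y
... | yes _    | no _     = refl
... | no _     | yes _    = refl
... | no _     | no _     = refl

module _ (G : Multipole) where

  joins⇒≢ : ∀ {e a b} → Joins G e a b → a ≢ b
  joins⇒≢ (inj₁ eq) a≡b = link-ne G _ (trans (cong proj₁ eq) (trans a≡b (sym (cong proj₂ eq))))
  joins⇒≢ (inj₂ eq) a≡b = link-ne G _ (trans (cong proj₁ eq) (trans (sym a≡b) (sym (cong proj₂ eq))))

  touches-joins : ∀ {e a b} w → Joins G e a b → touches (link G e) w ≡ 𝟙 (a Fin.≟ w) + 𝟙 (b Fin.≟ w)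
  touches-joins w e-ab@(inj₁ eq) rewrite eq = touches-≢ w (joins⇒≢ e-ab)
  touches-joins {a = a} {b} w e-ab@(inj₂ eq) rewrite eq =
    trans (touches-≢ w (joins⇒≢ e-ab ∘ sym)) (+-comm (𝟙 (b Fin.≟ w)) _)

  innerDeg≡sum : ∀ w → innerDeg G w ≡ sum (λ e → touches (link G e) w)
  innerDeg≡sum w = count≡sum (incident? G w)

  semiDeg≡sum : ∀ w → semiDeg G w ≡ sum (λ j → 𝟙 (semi G j Fin.≟ w))
  semiDeg≡sum w = count≡sum (λ j → semi G j Fin.≟ w)

module SwapEnd (G : Multipole) {e : Fin (nlinks G)} {a b : Fin (order G)} (e-ab : Joins G e a b)
               {j : Fin (nsemi G)} {x : Fin (order G)} (j-x : semi G j ≡ x) (x≢b : x ≢ b) where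

  link′ : Fin (nlinks G) → Fin (order G) × Fin (order G)
  link′ = updateAt (link G) e (λ _ → x , b)

  link′-e : link′ e ≡ (x , b)
  link′-e = updateAt-updates e (link G)

  link′-other : ∀ {f} → f ≢ e → link′ f ≡ link G f
  link′-other {f} f≢e = updateAt-minimal f e (link G) f≢e

  link′-ne : ∀ f → proj₁ (link′ f) ≢ proj₂ (link′ f)
  link′-ne f with f Fin.≟ e
  ... | yes refl = subst (λ xy → proj₁ xy ≢ proj₂ xy) (sym link′-e) x≢b
  ... | no f≢e   = subst (λ xy → proj₁ xy ≢ proj₂ xy) (sym (link′-other f≢e)) (link-ne G f)

  semi′ : Fin (nsemi G) → Fin (order G)
  semi′ = updateAt (semi G) j (λ _ → a)

  swapped : Multipole
  swapped = record G { link = link′ ; link-ne = link′-ne ; semi = semi′ }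

  semi′-j : semi′ j ≡ a
  semi′-j = updateAt-updates j (semi G)

  -- The ends are only exchanged: link e trades a for x, semiedge j trades x for a.
  degree-swapped : ∀ w → degree swapped w ≡ degree G w
  degree-swapped w = +-cancelʳ-≡ ([ a ] + [ b ] + [ x ]) _ _ (begin
    I′ + S′ + ([ a ] + [ b ] + [ x ])    ≡⟨ regroup I′ S′ [ a ] [ b ] [ x ] ⟩
    I′ + ([ a ] + [ b ]) + (S′ + [ x ])  ≡⟨ cong₂ _+_ links semis ⟩
    I + ([ x ] + [ b ]) + (S + [ a ])    ≡⟨ regroup′ I S [ a ] [ b ] [ x ] ⟩
    I + S + ([ a ] + [ b ] + [ x ])      ∎)
    where
    open ≡-Reasoning
    [_] : Fin (order G) → ℕ
    [ y ] = 𝟙 (y Fin.≟ w)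
    I I′ S S′ : ℕ
    I  = innerDeg G w
    I′ = innerDeg swapped w
    S  = semiDeg G w
    S′ = semiDeg swapped w
    regroup : ∀ i s a b x → i + s + (a + b + x) ≡ i + (a + b) + (s + x)
    regroup = solve-∀
    regroup′ : ∀ i s a b x → i + (x + b) + (s + a) ≡ i + s + (a + b + x)
    regroup′ = solve-∀
    links : I′ + ([ a ] + [ b ]) ≡ I + ([ x ] + [ b ])
    links = begin
      I′ + ([ a ] + [ b ])
        ≡⟨ cong₂ _+_ (innerDeg≡sum swapped w) (sym (touches-joins G w e-ab)) ⟩
      sum (λ f → touches (link′ f) w) + touches (link G e) w
        ≡⟨ sum-update _ _ e (λ f f≢e → cong (λ xy → touches xy w) (link′-other f≢e)) ⟩
      sum (λ f → touches (link G f) w) + touches (link′ e) w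
        ≡⟨ cong₂ _+_ (sym (innerDeg≡sum G w)) (trans (cong (λ xy → touches xy w) link′-e) (touches-≢ w x≢b)) ⟩
      I + ([ x ] + [ b ])
        ∎
    semis : S′ + [ x ] ≡ S + [ a ]
    semis = begin
      S′ + [ x ]
        ≡⟨ cong₂ _+_ (semiDeg≡sum swapped w) (cong [_] (sym j-x)) ⟩
      sum (λ i → [ semi′ i ]) + [ semi G j ]
        ≡⟨ sum-update _ _ j (λ i i≢j → cong [_] (updateAt-minimal i j (semi G) i≢j)) ⟩
      sum (λ i → [ semi G i ]) + [ semi′ j ]
        ≡⟨ cong₂ _+_ (sym (semiDeg≡sum G w)) (cong [_] semi′-j) ⟩
      S + [ a ]
        ∎

-- Joins G is Connects (link G).  Cycles are stated for a bare link function, so that a cycle can be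
-- rebuilt over the partly changed links of another multipole on the same vertices and links.
Connects : ∀ {m} → (Fin m → Fin n × Fin n) → Fin m → Fin n → Fin n → Set
Connects l e a b = (l e ≡ (a , b)) ⊎ (l e ≡ (b , a))

-- Cycles whose vertices and links are indexed by ℕ; only the indices below L (and vs L) carry
-- meaning.  Cutting and splicing cycles is then plain arithmetic on indices.
record Cycleℕ {m} (l : Fin m → Fin n × Fin n) (L : ℕ) : Set where
  field
    len≥2  : 2 ≤ L
    vs     : ℕ → Fin n
    es     : ℕ → Fin m
    closed : vs L ≡ vs 0
    vs-inj : ∀ {i j} → i < L → j < L → vs i ≡ vs j → i ≡ j
    es-inj : ∀ {i j} → i < L → j < L → es i ≡ es j → i ≡ j
    joins  : ∀ i → i < L → Connects l (es i) (vs i) (vs (suc i))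

mod-toℕ : ∀ {d i} .⦃ _ : NonZero d ⦄ (x : Fin d) → toℕ x ≡ i → i mod d ≡ x
mod-toℕ x refl = toℕ-injective (trans (toℕ-fromℕ< _) (m<n⇒m%n≡m (toℕ<n x)))

toℕ-onto : ∀ {i L} → i < L → ∃ λ (x : Fin L) → toℕ x ≡ i
toℕ-onto i<L = fromℕ< i<L , toℕ-fromℕ< i<L

module _ {G : Multipole} where

  toCycleℕ : ∀ {L} → Cycle G L → Cycleℕ (link G) L
  toCycleℕ {L} C = record
    { len≥2  = len≥2
    ; vs     = vs′
    ; es     = es′
    ; closed = trans (vs′-at (fromℕ L) (toℕ-fromℕ L)) (trans closed (sym (vs′-at zero refl)))
    ; vs-inj = vs′-inj
    ; es-inj = es′-inj
    ; joins  = joins′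
    }
    where
    open Cycle C
    instance
      L≢0 : NonZero L
      L≢0 = >-nonZero (≤-trans (s≤s z≤n) len≥2)
    vs′ : ℕ → Fin (order G)
    vs′ i = vs (i mod suc L)
    es′ : ℕ → Fin (nlinks G)
    es′ i = es (i mod L)
    vs′-at : ∀ {i} x → toℕ x ≡ i → vs′ i ≡ vs x
    vs′-at x eq = cong vs (mod-toℕ x eq)
    es′-at : ∀ {i} x → toℕ x ≡ i → es′ i ≡ es x
    es′-at x eq = cong es (mod-toℕ x eq)
    vs′-inj : ∀ {i j} → i < L → j < L → vs′ i ≡ vs′ j → i ≡ j
    vs′-inj i<L j<L eq with x , refl ← toℕ-onto i<L | y , refl ← toℕ-onto j<L =
      cong toℕ (vs-inj (trans (sym (vs′-at (inject₁ x) (toℕ-inject₁ x)))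
                       (trans eq (vs′-at (inject₁ y) (toℕ-inject₁ y)))))
    es′-inj : ∀ {i j} → i < L → j < L → es′ i ≡ es′ j → i ≡ j
    es′-inj i<L j<L eq with x , refl ← toℕ-onto i<L | y , refl ← toℕ-onto j<L =
      cong toℕ (es-inj (trans (sym (es′-at x refl)) (trans eq (es′-at y refl))))
    joins′ : ∀ i → i < L → Connects (link G) (es′ i) (vs′ i) (vs′ (suc i))
    joins′ i i<L with x , refl ← toℕ-onto i<L
      rewrite es′-at x refl | vs′-at (inject₁ x) (toℕ-inject₁ x) | vs′-at (suc x) refl = joins x

  fromCycleℕ : ∀ {L} → Cycleℕ (link G) L → Cycle G L
  fromCycleℕ {L} D = record
    { len≥2  = len≥2
    ; vs     = vs ∘ toℕ
    ; es     = es ∘ toℕ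
    ; closed = trans (cong vs (toℕ-fromℕ L)) closed
    ; vs-inj = λ {x} {y} eq → toℕ-injective (vs-inj (toℕ<n x) (toℕ<n y)
                 (subst₂ (λ i j → vs i ≡ vs j) (toℕ-inject₁ x) (toℕ-inject₁ y) eq))
    ; es-inj = λ {x} {y} eq → toℕ-injective (es-inj (toℕ<n x) (toℕ<n y) eq)
    ; joins  = λ x → subst (λ i → Connects (link G) (es (toℕ x)) (vs i) (vs (suc (toℕ x))))
                 (sym (toℕ-inject₁ x)) (joins (toℕ x) (toℕ<n x))
    }
    where open Cycleℕ D

module _ {m} {l : Fin m → Fin n × Fin n} {L} (D : Cycleℕ l L) where
  open Cycleℕ D

  len>0 : 0 < L
  len>0 = ≤-trans (s≤s z≤n) len≥2

  Avoids : Fin n → Set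
  Avoids x = ∀ i → i < L → vs i ≢ x

  avoids-≤ : ∀ {x} → Avoids x → ∀ i → i ≤ L → vs i ≢ x
  avoids-≤ avoids i i≤L with i ≟ L
  ... | yes refl = λ vsL≡x → avoids 0 len>0 (trans (sym closed) vsL≡x)
  ... | no i≢L   = avoids i (≤∧≢⇒< i≤L i≢L)

  relink : ∀ {l′} → (∀ i → i < L → Connects l′ (es i) (vs i) (vs (suc i))) → Cycleℕ l′ L
  relink joins′ = record
    { len≥2 = len≥2 ; vs = vs ; es = es ; closed = closed ; vs-inj = vs-inj ; es-inj = es-inj ; joins = joins′ }

  subdivide : ∀ {l′ x f} → Avoids x → (∀ i → i < L → es i ≢ f) →
    Connects l′ f (vs 0) x → Connects l′ (es 0) x (vs 1) →
    (∀ i → 0 < i → i < L → Connects l′ (es i) (vs i) (vs (suc i))) → Cycleℕ l′ (suc L)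
  subdivide {l′} {x} {f} avoids fresh f-joins e₀-joins joins′ = record
    { len≥2  = ≤-trans len≥2 (n≤1+n L)
    ; vs     = vs′
    ; es     = es′
    ; closed = trans (vs′-shift L len>0) closed
    ; vs-inj = vs′-inj
    ; es-inj = es′-inj
    ; joins  = joins″
    }
    where
    vs′ : ℕ → Fin n
    vs′ 0             = vs 0
    vs′ 1             = x
    vs′ (suc (suc i)) = vs (suc i)
    es′ : ℕ → Fin m
    es′ 0       = f
    es′ (suc i) = es i
    vs′-shift : ∀ i → 0 < i → vs′ (suc i) ≡ vs i
    vs′-shift (suc i) _ = refl
    vs′-inj : ∀ {i j} → i < suc L → j < suc L → vs′ i ≡ vs′ j → i ≡ j
    vs′-inj {0}           {0}           _   _   _  = refl
    vs′-inj {0}           {1}           _   _   eq = contradiction eq (avoids 0 len>0)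
    vs′-inj {0}           {suc (suc j)} _   j<L eq with () ← vs-inj len>0 (≤-pred j<L) eq
    vs′-inj {1}           {0}           _   _   eq = contradiction (sym eq) (avoids 0 len>0)
    vs′-inj {1}           {1}           _   _   _  = refl
    vs′-inj {1}           {suc (suc j)} _   j<L eq = contradiction (sym eq) (avoids (suc j) (≤-pred j<L))
    vs′-inj {suc (suc i)} {0}           i<L _   eq with () ← vs-inj (≤-pred i<L) len>0 eq
    vs′-inj {suc (suc i)} {1}           i<L _   eq = contradiction eq (avoids (suc i) (≤-pred i<L))
    vs′-inj {suc (suc i)} {suc (suc j)} i<L j<L eq = cong suc (vs-inj (≤-pred i<L) (≤-pred j<L) eq)
    es′-inj : ∀ {i j} → i < suc L → j < suc L → es′ i ≡ es′ j → i ≡ j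
    es′-inj {0}     {0}     _   _   _  = refl
    es′-inj {0}     {suc j} _   j<L eq = contradiction (sym eq) (fresh j (≤-pred j<L))
    es′-inj {suc i} {0}     i<L _   eq = contradiction eq (fresh i (≤-pred i<L))
    es′-inj {suc i} {suc j} i<L j<L eq = cong suc (es-inj (≤-pred i<L) (≤-pred j<L) eq)
    joins″ : ∀ i → i < suc L → Connects l′ (es′ i) (vs′ i) (vs′ (suc i))
    joins″ 0             _   = f-joins
    joins″ 1             _   = e₀-joins
    joins″ (suc (suc i)) i<L = joins′ (suc i) z<s (≤-pred i<L)

  private
    instance
      L≢0 : NonZero L
      L≢0 = >-nonZero len>0

    next : ℕ → ℕ
    next i = suc i % L

    next-view : ∀ {i} → i < L → (suc i < L × next i ≡ suc i) ⊎ (suc i ≡ L × next i ≡ 0)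
    next-view {i} i<L with suc i ≟ L
    ... | yes refl = inj₂ (refl , n%n≡0 L)
    ... | no i+1≢L = inj₁ (≤∧≢⇒< i<L i+1≢L , m<n⇒m%n≡m (≤∧≢⇒< i<L i+1≢L))

    next-inj : ∀ {i j} → i < L → j < L → next i ≡ next j → i ≡ j
    next-inj i<L j<L eq with next-view i<L | next-view j<L
    ... | inj₁ (_ , ni) | inj₁ (_ , nj) = suc-injective (trans (sym ni) (trans eq nj))
    ... | inj₁ (_ , ni) | inj₂ (_ , nj) with () ← trans (sym ni) (trans eq nj)
    ... | inj₂ (_ , ni) | inj₁ (_ , nj) with () ← trans (sym nj) (trans (sym eq) ni)
    ... | inj₂ (i+1≡L , _) | inj₂ (j+1≡L , _) = suc-injective (trans i+1≡L (sym j+1≡L))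

    vs-next : ∀ {i} → i < L → vs (next i) ≡ vs (suc i)
    vs-next i<L with next-view i<L
    ... | inj₁ (_ , ni)    = cong vs ni
    ... | inj₂ (refl , ni) = trans (cong vs ni) (sym closed)

  rotate : Cycleℕ l L
  rotate = record
    { len≥2  = len≥2
    ; vs     = vs ∘ next
    ; es     = es ∘ next
    ; closed = cong vs ([m+n]%n≡m%n 1 L)
    ; vs-inj = λ i<L j<L eq → next-inj i<L j<L (vs-inj (m%n<n _ L) (m%n<n _ L) eq)
    ; es-inj = λ i<L j<L eq → next-inj i<L j<L (es-inj (m%n<n _ L) (m%n<n _ L) eq)
    ; joins  = λ i i<L → subst (Connects l (es (next i)) (vs (next i))) (vs-next-suc i<L)
                 (joins (next i) (m%n<n _ L))
    }
    where
    vs-next-suc : ∀ {i} → i < L → vs (suc (next i)) ≡ vs (next (suc i))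
    vs-next-suc {i} i<L with next-view i<L
    ... | inj₂ (refl , ni) = cong vs (trans (cong suc ni) (sym (trans ([m+n]%n≡m%n 1 L) (m<n⇒m%n≡m len≥2))))
    ... | inj₁ (i+1<L , ni) = trans (cong vs (cong suc ni)) (sym (vs-next i+1<L))

  rotate-vs : ∀ i → i < L → Cycleℕ.vs rotate i ≡ vs (suc i)
  rotate-vs i = vs-next

module _ {m} {l : Fin m → Fin n × Fin n} where
  open Cycleℕ

  shift-to-1 : ∀ {L x} (D : Cycleℕ l L) q → suc q ≤ L → vs D (suc q) ≡ x →
    Σ (Cycleℕ l L) λ D′ → vs D′ 1 ≡ x
  shift-to-1 D zero    _     at-x = D , at-x
  shift-to-1 D (suc q) q+1<L at-x =
    shift-to-1 (rotate D) q (<⇒≤ q+1<L) (trans (rotate-vs D (suc q) q+1<L) at-x)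

  rotate-to-1 : ∀ {L x} (D : Cycleℕ l L) p → p < L → vs D p ≡ x →
    Σ (Cycleℕ l L) λ D′ → vs D′ 1 ≡ x
  rotate-to-1 {suc L} D zero    _     at-x = shift-to-1 D L ≤-refl (trans (closed D) at-x)
  rotate-to-1         D (suc q) q+1<L at-x = shift-to-1 D q (<⇒≤ q+1<L) at-x

module _ {m} {l l′ : Fin m → Fin n × Fin n} {L} (D : Cycleℕ l (suc L)) where
  open Cycleℕ D

  contract : ∀ {e} → Connects l′ e (vs 0) (vs 2) → vs 0 ≢ vs 2 →
    (∀ i → 2 ≤ i → i < suc L → es i ≢ e × Connects l′ (es i) (vs i) (vs (suc i))) → Cycleℕ l′ L
  contract {e} e-joins ends≢ rest = record
    { len≥2  = len≥2′ L refl
    ; vs     = vs′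
    ; es     = es′
    ; closed = trans (vs′-shift L (≤-trans (s≤s z≤n) (len≥2′ L refl))) closed
    ; vs-inj = vs′-inj
    ; es-inj = es′-inj
    ; joins  = joins′
    }
    where
    vs′ : ℕ → Fin n
    vs′ 0       = vs 0
    vs′ (suc i) = vs (suc (suc i))
    es′ : ℕ → Fin m
    es′ 0       = e
    es′ (suc i) = es (suc (suc i))
    len≥2′ : ∀ k → k ≡ L → 2 ≤ k
    len≥2′ 0             refl = contradiction len≥2 λ { (s≤s ()) }
    len≥2′ 1             refl = contradiction (sym closed) ends≢
    len≥2′ (suc (suc k)) _    = s≤s (s≤s z≤n)
    vs′-shift : ∀ i → 0 < i → vs′ i ≡ vs (suc i)
    vs′-shift (suc i) _ = refl
    vs′-inj : ∀ {i j} → i < L → j < L → vs′ i ≡ vs′ j → i ≡ j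
    vs′-inj {0}     {0}     _   _   _  = refl
    vs′-inj {0}     {suc j} _   j<L eq with () ← vs-inj z<s (s≤s j<L) eq
    vs′-inj {suc i} {0}     i<L _   eq with () ← vs-inj (s≤s i<L) z<s eq
    vs′-inj {suc i} {suc j} i<L j<L eq = suc-injective (vs-inj (s≤s i<L) (s≤s j<L) eq)
    es′-inj : ∀ {i j} → i < L → j < L → es′ i ≡ es′ j → i ≡ j
    es′-inj {0}     {0}     _   _   _  = refl
    es′-inj {0}     {suc j} _   j<L eq = contradiction (sym eq) (proj₁ (rest (2 + j) (s≤s (s≤s z≤n)) (s≤s j<L)))
    es′-inj {suc i} {0}     i<L _   eq = contradiction eq (proj₁ (rest (2 + i) (s≤s (s≤s z≤n)) (s≤s i<L)))
    es′-inj {suc i} {suc j} i<L j<L eq = suc-injective (es-inj (s≤s i<L) (s≤s j<L) eq)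
    joins′ : ∀ i → i < L → Connects l′ (es′ i) (vs′ i) (vs′ (suc i))
    joins′ 0       _   = e-joins
    joins′ (suc i) i<L = proj₂ (rest (suc (suc i)) (s≤s (s≤s z≤n)) (s≤s i<L))

connects-sym : ∀ {m} {l : Fin m → Fin n × Fin n} {e a b} → Connects l e a b → Connects l e b a
connects-sym (inj₁ eq) = inj₂ eq
connects-sym (inj₂ eq) = inj₁ eq

connects-resp : ∀ {m} {l l′ : Fin m → Fin n × Fin n} {e a b} →
  l′ e ≡ l e → Connects l e a b → Connects l′ e a b
connects-resp {a = a} {b} eq = subst (λ xy → (xy ≡ (a , b)) ⊎ (xy ≡ (b , a))) (sym eq)

module _ (G : Multipole) where

  joins⇒incident₁ : ∀ {e a b} → Joins G e a b → Incident G e a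
  joins⇒incident₁ (inj₁ eq) = inj₁ (cong proj₁ eq)
  joins⇒incident₁ (inj₂ eq) = inj₂ (cong proj₂ eq)

  joins⇒incident₂ : ∀ {e a b} → Joins G e a b → Incident G e b
  joins⇒incident₂ (inj₁ eq) = inj₂ (cong proj₂ eq)
  joins⇒incident₂ (inj₂ eq) = inj₁ (cong proj₁ eq)

  incident⇒end : ∀ {e a b w} → Joins G e a b → Incident G e w → w ≡ a ⊎ w ≡ b
  incident⇒end (inj₁ eq) (inj₁ refl) = inj₁ (cong proj₁ eq)
  incident⇒end (inj₁ eq) (inj₂ refl) = inj₂ (cong proj₂ eq)
  incident⇒end (inj₂ eq) (inj₁ refl) = inj₂ (cong proj₁ eq)
  incident⇒end (inj₂ eq) (inj₂ refl) = inj₁ (cong proj₂ eq)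

  incident⇒joins : ∀ {e w} → Incident G e w → ∃ λ u → Joins G e u w
  incident⇒joins (inj₁ refl) = _ , inj₂ refl
  incident⇒joins (inj₂ refl) = _ , inj₁ refl

  joins-other-end : ∀ {e a b x} → Joins G e a x → Joins G e b x → a ≡ b
  joins-other-end (inj₁ p) (inj₁ q) = cong proj₁ (trans (sym p) q)
  joins-other-end (inj₂ p) (inj₂ q) = cong proj₂ (trans (sym p) q)
  joins-other-end (inj₁ p) (inj₂ q) = contradiction (trans (cong proj₁ q) (sym (cong proj₂ p))) (link-ne G _)
  joins-other-end (inj₂ p) (inj₁ q) = contradiction (trans (cong proj₁ p) (sym (cong proj₂ q))) (link-ne G _)

  cycle-innerDeg≥2 : ∀ {L} (D : Cycleℕ (link G) L) i → i < L → 2 ≤ innerDeg G (Cycleℕ.vs D i)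
  cycle-innerDeg≥2 {suc L} D 0 _ =
    ≢⇒count≥2 (incident? G _) es₀≢esL (joins⇒incident₁ (joins 0 z<s))
      (subst (Incident G (es L)) closed (joins⇒incident₂ (joins L ≤-refl)))
    where
    open Cycleℕ D
    es₀≢esL : es 0 ≢ es L
    es₀≢esL eq with refl ← es-inj z<s ≤-refl eq = contradiction len≥2 λ { (s≤s ()) }
  cycle-innerDeg≥2 D (suc i) i+1<L =
    ≢⇒count≥2 (incident? G _) (λ eq → 1+n≢n (es-inj i+1<L (<-trans (n<1+n i) i+1<L) eq))
      (joins⇒incident₁ (joins (suc i) i+1<L)) (joins⇒incident₂ (joins i (<-trans (n<1+n i) i+1<L)))
    where open Cycleℕ D

  cycle-length≤nlinks : ∀ {L} → Cycle G L → L ≤ nlinks G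
  cycle-length≤nlinks C = injective⇒≤ (Cycle.es-inj C)

  gCycle⇒cycle-length≤g : ∀ {k g L} → IsGCycle G k g → Cycle G L → L ≤ g
  gCycle⇒cycle-length≤g (cyc , _ , onto , _) C =
    ≤-trans (cycle-length≤nlinks C) (injective⇒≤ {f = proj₁ ∘ onto} λ {e} {e′} eq →
      trans (sym (proj₂ (onto e))) (trans (cong (Cycle.es cyc) eq) (proj₂ (onto e′))))

module PendantStep (G : Multipole) {k g ℓ : ℕ} (regular : KRegular G k) (girth : GirthAtLeast G g)
                   (C : Cycleℕ (link G) ℓ) {v : Fin (order G)} (pendant : innerDeg G v ≡ 1) where
  private module C = Cycleℕ C

  private
    link-at-v : ∃ λ e → Incident G e v
    link-at-v = count≥1⇒∃ (incident? G v) (≤-reflexive (sym pendant))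

  e₀ : Fin (nlinks G)
  e₀ = proj₁ link-at-v

  at-v⇒e₀ : ∀ {e} → Incident G e v → e ≡ e₀
  at-v⇒e₀ e-v = count≤1⇒unique (incident? G v) (≤-reflexive pendant) e-v (proj₂ link-at-v)

  u : Fin (order G)
  u = proj₁ (incident⇒joins G (proj₂ link-at-v))

  e₀-uv : Joins G e₀ u v
  e₀-uv = proj₂ (incident⇒joins G (proj₂ link-at-v))

  C-avoids-v : Avoids C v
  C-avoids-v i i<ℓ refl = contradiction (subst (2 ≤_) pendant (cycle-innerDeg≥2 G C i i<ℓ)) λ { (s≤s ()) }

  C-es≢e₀ : ∀ i → i < ℓ → C.es i ≢ e₀
  C-es≢e₀ i i<ℓ esᵢ≡e₀
    with incident⇒end G (C.joins i i<ℓ) (subst (λ e → Incident G e v) (sym esᵢ≡e₀) (proj₂ link-at-v))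
  ... | inj₁ v≡vsᵢ   = C-avoids-v i i<ℓ (sym v≡vsᵢ)
  ... | inj₂ v≡vsᵢ₊₁ = avoids-≤ C C-avoids-v (suc i) i<ℓ (sym v≡vsᵢ₊₁)

  c₀ c₁ : Fin (order G)
  c₀ = C.vs 0
  c₁ = C.vs 1

  e₁ : Fin (nlinks G)
  e₁ = C.es 0

  e₁-c₀c₁ : Joins G e₁ c₀ c₁
  e₁-c₀c₁ = C.joins 0 (len>0 C)

  c₀≢v : c₀ ≢ v
  c₀≢v = C-avoids-v 0 (len>0 C)

  v≢c₁ : v ≢ c₁
  v≢c₁ = C-avoids-v 1 C.len≥2 ∘ sym

  e₁≢e₀ : e₁ ≢ e₀
  e₁≢e₀ = C-es≢e₀ 0 (len>0 C)

  semi-at-v : ∃ λ j → semi G j ≡ v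
  semi-at-v = count≥1⇒∃ (λ j → semi G j Fin.≟ v) semiDeg≥1
    where
    k≥2 : 2 ≤ k
    k≥2 = ≤-trans (cycle-innerDeg≥2 G C 0 (len>0 C)) (subst (innerDeg G c₀ ≤_) (regular c₀) (m≤m+n _ _))
    semiDeg≥1 : 1 ≤ semiDeg G v
    semiDeg≥1 =
      +-cancelˡ-≤ 1 1 _ (subst (2 ≤_) (trans (sym (regular v)) (cong (_+ semiDeg G v) pendant)) k≥2)

  -- First e₁ = c₀c₁ becomes vc₁ while the semiedge at v moves to c₀; then e₀ = uv becomes c₀v
  -- while that semiedge moves on to u.
  private
    module First = SwapEnd G e₁-c₀c₁ (proj₂ semi-at-v) v≢c₁

    e₀-uv′ : Joins First.swapped e₀ u v
    e₀-uv′ = connects-resp {l = link G} {l′ = First.link′} (First.link′-other (e₁≢e₀ ∘ sym)) e₀-uv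

    module Second = SwapEnd First.swapped e₀-uv′ First.semi′-j c₀≢v

  H : Multipole
  H = Second.swapped

  H-regular : KRegular H k
  H-regular w = trans (Second.degree-swapped w) (trans (First.degree-swapped w) (regular w))

  H-e₀ : Connects (link H) e₀ c₀ v
  H-e₀ = inj₁ Second.link′-e

  H-e₁ : Connects (link H) e₁ c₁ v
  H-e₁ = inj₂ (trans (Second.link′-other e₁≢e₀) First.link′-e)

  H-other : ∀ {f} → f ≢ e₀ → f ≢ e₁ → link H f ≡ link G f
  H-other f≢e₀ f≢e₁ = trans (Second.link′-other f≢e₀) (First.link′-other f≢e₁)

  joins-H⇒G : ∀ {f a b} → f ≢ e₀ → f ≢ e₁ → Joins H f a b → Joins G f a b
  joins-H⇒G f≢e₀ f≢e₁ = connects-resp {l = link H} {l′ = link G} (sym (H-other f≢e₀ f≢e₁))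

  joins-G⇒H : ∀ {f a b} → f ≢ e₀ → f ≢ e₁ → Joins G f a b → Joins H f a b
  joins-G⇒H f≢e₀ f≢e₁ = connects-resp {l = link G} {l′ = link H} (H-other f≢e₀ f≢e₁)

  neighbour-of-v : ∀ {f a} → Joins H f a v → (f ≡ e₀ × a ≡ c₀) ⊎ (f ≡ e₁ × a ≡ c₁)
  neighbour-of-v {f} f-av with f Fin.≟ e₀ | f Fin.≟ e₁
  ... | yes refl | _        = inj₁ (refl , joins-other-end H f-av H-e₀)
  ... | no _     | yes refl = inj₂ (refl , joins-other-end H f-av H-e₁)
  ... | no f≢e₀  | no f≢e₁  = contradiction (at-v⇒e₀ (joins⇒incident₂ G (joins-H⇒G f≢e₀ f≢e₁ f-av))) f≢e₀

  longer : Cycleℕ (link H) (suc ℓ)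
  longer = subdivide C C-avoids-v C-es≢e₀ H-e₀ (connects-sym {l = link H} H-e₁) λ i 0<i i<ℓ →
    joins-G⇒H (C-es≢e₀ i i<ℓ) (λ eq → <⇒≢ 0<i (sym (C.es-inj i<ℓ (len>0 C) eq))) (C.joins i i<ℓ)

  avoiding-v : ∀ {f a b} → Joins H f a b → a ≢ v → b ≢ v → f ≢ e₀ × f ≢ e₁
  avoiding-v {f} f-ab a≢v b≢v = not-via H-e₀ , not-via H-e₁
    where
    not-via : ∀ {e c} → Joins H e c v → f ≢ e
    not-via e-cv refl with incident⇒end H f-ab (joins⇒incident₂ H e-cv)
    ... | inj₁ v≡a = a≢v (sym v≡a)
    ... | inj₂ v≡b = b≢v (sym v≡b)

  through-v : ∀ {f f′ a b} → Joins H f a v → Joins H f′ b v → f ≢ f′ →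
    Joins G e₁ a b × (∀ {h} → h ≢ f → h ≢ f′ → h ≢ e₀ × h ≢ e₁)
  through-v f-av f′-bv f≢f′ with neighbour-of-v f-av | neighbour-of-v f′-bv
  ... | inj₁ (refl , refl) | inj₂ (refl , refl) = e₁-c₀c₁ , λ h≢e₀ h≢e₁ → h≢e₀ , h≢e₁
  ... | inj₂ (refl , refl) | inj₁ (refl , refl) =
    connects-sym {l = link G} e₁-c₀c₁ , λ h≢e₁ h≢e₀ → h≢e₀ , h≢e₁
  ... | inj₁ (refl , _)    | inj₁ (refl , _)    = contradiction refl f≢f′
  ... | inj₂ (refl , _)    | inj₂ (refl , _)    = contradiction refl f≢f′

  off-v : ∀ {L} (D : Cycleℕ (link H) L) → Avoids D v → Cycleℕ (link G) L
  off-v D avoids = relink D λ i i<L →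
    let f≢e₀ , f≢e₁ = avoiding-v (joins i i<L) (avoids i i<L) (avoids-≤ D avoids (suc i) i<L)
    in joins-H⇒G f≢e₀ f≢e₁ (joins i i<L)
    where open Cycleℕ D

  bypass : ∀ {L} (D : Cycleℕ (link H) (suc L)) → Cycleℕ.vs D 1 ≡ v → Cycleℕ (link G) L
  bypass {L} D vs₁≡v = contract D e₁-joins (joins⇒≢ G e₁-joins) rest
    where
    open Cycleℕ D
    es₀≢es₁ : es 0 ≢ es 1
    es₀≢es₁ eq with () ← es-inj z<s len≥2 eq
    es₀-in : Joins H (es 0) (vs 0) v
    es₀-in = subst (Joins H (es 0) (vs 0)) vs₁≡v (joins 0 z<s)
    es₁-in : Joins H (es 1) (vs 2) v
    es₁-in = connects-sym {l = link H} (subst (λ x → Joins H (es 1) x (vs 2)) vs₁≡v (joins 1 len≥2))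
    e₁-joins : Joins G e₁ (vs 0) (vs 2)
    e₁-joins = proj₁ (through-v es₀-in es₁-in es₀≢es₁)
    rest : ∀ i → 2 ≤ i → i < suc L → es i ≢ e₁ × Joins G (es i) (vs i) (vs (suc i))
    rest i 2≤i i<L = proj₂ fresh , joins-H⇒G (proj₁ fresh) (proj₂ fresh) (joins i i<L)
      where
      fresh : es i ≢ e₀ × es i ≢ e₁
      fresh = proj₂ (through-v es₀-in es₁-in es₀≢es₁)
        (λ eq → <⇒≢ (≤-trans (s≤s z≤n) 2≤i) (sym (es-inj i<L z<s eq)))
        (λ eq → <⇒≢ 2≤i (sym (es-inj i<L len≥2 eq)))

  shorten : ∀ {L} → Cycleℕ (link H) L → Σ ℕ λ L′ → L′ ≤ L × Cycleℕ (link G) L′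
  shorten {zero}  D = contradiction (Cycleℕ.len≥2 D) λ ()
  shorten {suc L} D with anyUpTo? (λ i → Cycleℕ.vs D i Fin.≟ v) (suc L)
  ... | no v∉D = suc L , ≤-refl , off-v D λ i i<L vsᵢ≡v → v∉D (i , i<L , vsᵢ≡v)
  ... | yes (p , p<L , vsₚ≡v) with D′ , vs₁≡v ← rotate-to-1 D p p<L vsₚ≡v =
    L , n≤1+n L , bypass D′ vs₁≡v

  H-girth : GirthAtLeast H g
  H-girth L cyc with L′ , L′≤L , D ← shorten (toCycleℕ cyc) =
    ≤-trans (girth L′ (fromCycleℕ D)) L′≤L

module _ {k g s : ℕ} (s+2g≤kg : s + 2 * g ≤ k * g) where

  Pruned : Multipole → Set
  Pruned G = Σ Multipole λ H → Nontrivial k g s H × order H ≡ order G × (∀ v → innerDeg H v ≢ 1)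

  -- t bounds the remaining steps: the cycle grows by one per step and never exceeds nlinks G.
  prune : ∀ t (G : Multipole) {ℓ} → IsKGS k g s G → ¬ IsGCycle G k g → Cycleℕ (link G) ℓ →
    nlinks G ≤ ℓ + t → Pruned G
  prune-pendant : ∀ t (G : Multipole) {ℓ v} → IsKGS k g s G → Cycleℕ (link G) ℓ →
    nlinks G ≤ ℓ + t → innerDeg G v ≡ 1 → Pruned G

  prune t G kgs not-g C bound with any? (λ v → innerDeg G v ≟ 1)
  ... | no none           = G , (kgs , s+2g≤kg , (_ , fromCycleℕ C) , not-g) , refl , λ v p → none (v , p)
  ... | yes (_ , pendant) = prune-pendant t G kgs C bound pendant

  prune-pendant zero G {ℓ} (regular , girth , _) C bound pendant =
    contradiction (≤-trans (cycle-length≤nlinks H (fromCycleℕ longer)) (subst (nlinks G ≤_) (+-identityʳ ℓ) bound))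
      1+n≰n
    where open PendantStep G regular girth C pendant
  prune-pendant (suc t) G {ℓ} (regular , girth , nsemi≡s) C bound pendant =
    prune t H (H-regular , H-girth , nsemi≡s) H-not-g-cycle longer (subst (nlinks G ≤_) (+-suc ℓ t) bound)
    where
    open PendantStep G regular girth C pendant
    H-not-g-cycle : ¬ IsGCycle H k g
    H-not-g-cycle g-cycle = 1+n≰n (≤-trans (gCycle⇒cycle-length≤g H {k = k} g-cycle (fromCycleℕ longer))
                                          (girth ℓ (fromCycleℕ C)))

lemma1 : (k g s : ℕ) (G : Multipole) → Nontrivial k g s G →
    Σ Multipole (λ H → Nontrivial k g s H × order H ≡ order G ×
      (∀ v → innerDeg H v ≢ 1))
lemma1 k g s G (kgs , s+2g≤kg , (ℓ , C) , not-g-cycle) =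
  prune s+2g≤kg (nlinks G) G kgs not-g-cycle (toCycleℕ C) (m≤n+m (nlinks G) ℓ)
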